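{- Let $M$ be the minimum size of a family $\mathcal{F}$ of $6$-element subsets of $[60]=\{1,\dots,60\}$ such that for every $6$-subset $S\subset[60]$ there exists $B\in\mathcal{F}$ with $|S\cap B|\ge 3$. Then $M\ge 97$. -}

module Defs where

open import Data.Nat using (ℕ; _≤_)
open import Data.Fin.Subset using (Subset; ∣_∣; _∩_)
open import Data.List using (List)
open import Data.List.Relation.Unary.All using (All)
open import Data.List.Relation.Unary.Any using (Any)
open import Data.Product using (_×_)
open import Relation.Binary.PropositionalEquality using (_≡_)

IsCovering : (n k t : ℕ) → List (Subset n) → Set
IsCovering n k t F =
  All (λ B → ∣ B ∣ ≡ k) F ×
  ((S : Subset n) → ∣ S ∣ ≡ k → Any (λ B → t ≤ ∣ S ∩ B ∣) F)

{-# OPTIONS --safe #-}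
-- Double counting. Whether a k-set S meets a fixed set B in at least t points can be
-- decided one point at a time along the characteristic vectors, so the number of such S
-- depends only on |B| and |∁ B|; for |B| = 6 in [60] it is Σ_{i ≥ 3} (6 C i) (54 C (6 ∸ i))
-- = 517870. By the union bound a covering F has 60 C 6 = 50063860 ≤ |F| · 517870, while
-- 96 · 517870 < 50063860.
module Submission where

open import Defs
open import Data.Nat using (_≤_)
open import Data.List using (List; length)
open import Data.Fin.Subset using (Subset)

open import Level using (Level)
open import Data.Bool.Base using (if_then_else_)
open import Data.Nat.Base using (ℕ; zero; suc; _+_; _*_; _∸_; _<_; z≤n)
open import Data.Nat.Properties
open import Data.Nat.Combinatorics using (_C_; nCk+nC[k+1]≡[n+1]C[k+1])
open import Data.List.Base using ([]; _∷_; [_]; _++_; map)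
open import Data.Nat.ListAction using (sum)
open import Data.List.Properties using (length-++; length-map; map-++; map-∘; map-cong)
open import Data.Nat.ListAction.Properties using (sum-++)
open import Data.List.Relation.Unary.All as All using (All; []; _∷_)
open import Data.List.Relation.Unary.All.Properties using (++⁺; map⁺)
open import Data.List.Relation.Unary.Any using (Any; here; there)
open import Data.Vec.Base using ([]; _∷_)
open import Data.Fin.Subset using (∣_∣; _∩_; ∁; ⊥; inside; outside)
open import Data.Fin.Subset.Properties using (∣⊥∣≡0; ∩-zeroˡ; ∣∁p∣≡n∸∣p∣)
open import Data.Product.Base using (_,_)
open import Function.Base using (_∘_)
open import Function.Bundles using (_⇔_; mk⇔)
open import Relation.Nullary.Decidable using (Dec; does; dec-true; does-⇔)
open import Relation.Unary using (Pred; Decidable)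
open import Relation.Binary.PropositionalEquality using (_≡_; refl; sym; trans; cong; cong₂; module ≡-Reasoning)
open import Algebra.Properties.CommutativeSemigroup +-commutativeSemigroup
  using (interchange; x∙yz≈y∙xz)

private
  variable
    a ℓ : Level
    A B : Set a

𝟙 : {P : Set ℓ} → Dec P → ℕ
𝟙 P? = if does P? then 1 else 0

𝟙-⇔ : {P Q : Set ℓ} (P? : Dec P) (Q? : Dec Q) → P ⇔ Q → 𝟙 P? ≡ 𝟙 Q?
𝟙-⇔ P? Q? P⇔Q = cong (λ b → if b then 1 else 0) (does-⇔ P⇔Q P? Q?)

𝟙-yes : {P : Set ℓ} (P? : Dec P) → P → 𝟙 P? ≡ 1
𝟙-yes P? p = cong (λ b → if b then 1 else 0) (dec-true P? p)

count : {P : Pred A ℓ} → Decidable P → List A → ℕ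
count P? xs = sum (map (𝟙 ∘ P?) xs)

sum-map-+ : (f g : A → ℕ) (xs : List A) →
            sum (map (λ x → f x + g x) xs) ≡ sum (map f xs) + sum (map g xs)
sum-map-+ f g []       = refl
sum-map-+ f g (x ∷ xs) =
  trans (cong (f x + g x +_) (sum-map-+ f g xs)) (interchange (f x) (g x) _ _)

sum-map-const : (f : A → ℕ) {c : ℕ} {xs : List A} →
                All (λ x → f x ≡ c) xs → sum (map f xs) ≡ length xs * c
sum-map-const f []             = refl
sum-map-const f (fx≡c ∷ fxs≡c) = cong₂ _+_ fx≡c (sum-map-const f fxs≡c)

sum-map-∘ : (f : B → ℕ) (g : A → B) (xs : List A) →
            sum (map f (map g xs)) ≡ sum (map (f ∘ g) xs)
sum-map-∘ f g xs = cong sum (sym (map-∘ xs))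

sum-map-++ : (f : A → ℕ) (xs ys : List A) →
             sum (map f (xs ++ ys)) ≡ sum (map f xs) + sum (map f ys)
sum-map-++ f xs ys = trans (cong sum (map-++ f xs ys)) (sum-++ (map f xs) (map f ys))

module _ {P : Pred A ℓ} (P? : Decidable P) where

  any⇒0<count : {xs : List A} → Any P xs → 0 < count P? xs
  any⇒0<count (here {x} px) = ≤-trans (≤-reflexive (sym (𝟙-yes (P? x) px))) (m≤m+n _ _)
  any⇒0<count (there {x} p) = ≤-trans (any⇒0<count p) (m≤n+m _ (𝟙 (P? x)))

  count-⇔ : {Q : Pred A ℓ} (Q? : Decidable Q) → (∀ {x} → P x ⇔ Q x) →
            (xs : List A) → count P? xs ≡ count Q? xs
  count-⇔ Q? P⇔Q = cong sum ∘ map-cong (λ x → 𝟙-⇔ (P? x) (Q? x) P⇔Q)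

  count-++-map : (f g : B → A) (xs ys : List B) →
                 count P? (map f xs ++ map g ys) ≡ count (P? ∘ f) xs + count (P? ∘ g) ys
  count-++-map f g xs ys = trans (sum-map-++ (𝟙 ∘ P?) (map f xs) (map g ys))
    (cong₂ _+_ (sum-map-∘ (𝟙 ∘ P?) f xs) (sum-map-∘ (𝟙 ∘ P?) g ys))

module _ {P : B → Pred A ℓ} (P? : ∀ b → Decidable (P b)) (F : List B) where

  length≤sum-count : {xs : List A} → All (λ x → Any (λ b → P b x) F) xs →
                     length xs ≤ sum (map (λ b → count (P? b) xs) F)
  length≤sum-count []                   = z≤n
  length≤sum-count {x ∷ xs} (x∈⋃ ∷ xs⊆⋃) = begin
    suc (length xs)
      ≤⟨ +-mono-≤ (any⇒0<count (λ b → P? b x) x∈⋃) (length≤sum-count xs⊆⋃) ⟩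
    sum (map (λ b → 𝟙 (P? b x)) F) + sum (map (λ b → count (P? b) xs) F)
      ≡⟨ sum-map-+ (λ b → 𝟙 (P? b x)) (λ b → count (P? b) xs) F ⟨
    sum (map (λ b → count (P? b) (x ∷ xs)) F) ∎
    where open ≤-Reasoning

-- #meeting a c k t is the number of k-subsets of a set with a points inside a fixed
-- subset and c points outside it, that contain at least t of the inside points.
-- The truncation t ∸ 1 is harmless at t = 0, where every subset qualifies.
#meeting : (a c k t : ℕ) → ℕ
#meeting a       c zero    t = 𝟙 (t ≤? 0)
#meeting zero    c (suc k) t = 𝟙 (t ≤? 0) * (c C suc k)
#meeting (suc a) c (suc k) t = #meeting a c k (t ∸ 1) + #meeting a c (suc k) t

#meeting-zero-inside : (c k t : ℕ) → #meeting 0 c k t ≡ 𝟙 (t ≤? 0) * (c C k)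
#meeting-zero-inside c zero    t = sym (*-identityʳ (𝟙 (t ≤? 0)))
#meeting-zero-inside c (suc k) t = refl

#meeting-suc-outside : (a c k t : ℕ) →
  #meeting a (suc c) (suc k) t ≡ #meeting a c k t + #meeting a c (suc k) t
#meeting-suc-outside zero c k t = begin
  𝟙 (t ≤? 0) * (suc c C suc k)
    ≡⟨ cong (𝟙 (t ≤? 0) *_) (nCk+nC[k+1]≡[n+1]C[k+1] c k) ⟨
  𝟙 (t ≤? 0) * (c C k + c C suc k)
    ≡⟨ *-distribˡ-+ (𝟙 (t ≤? 0)) (c C k) (c C suc k) ⟩
  𝟙 (t ≤? 0) * (c C k) + 𝟙 (t ≤? 0) * (c C suc k)
    ≡⟨ cong (_+ 𝟙 (t ≤? 0) * (c C suc k)) (#meeting-zero-inside c k t) ⟨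
  #meeting 0 c k t + #meeting 0 c (suc k) t ∎
  where open ≡-Reasoning
#meeting-suc-outside (suc a) c zero t =
  trans (cong (𝟙 (t ∸ 1 ≤? 0) +_) (#meeting-suc-outside a c zero t))
        (x∙yz≈y∙xz (𝟙 (t ∸ 1 ≤? 0)) (𝟙 (t ≤? 0)) (#meeting a c 1 t))
#meeting-suc-outside (suc a) c (suc k) t =
  trans (cong₂ _+_ (#meeting-suc-outside a c k (t ∸ 1)) (#meeting-suc-outside a c (suc k) t))
        (interchange (#meeting a c k (t ∸ 1)) _ _ _)

≤-suc⇔∸1≤ : (t r : ℕ) → t ≤ suc r ⇔ t ∸ 1 ≤ r
≤-suc⇔∸1≤ t r = mk⇔ (∸-monoˡ-≤ 1) (λ t∸1≤r → ≤-trans (m≤n+m∸n t 1) (+-monoʳ-≤ 1 t∸1≤r))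

-- Opaque: otherwise conversion checking may unfold the 60 C 6 subsets of size 6.
opaque
  subsetsOfSize : (n k : ℕ) → List (Subset n)
  subsetsOfSize n       zero    = [ ⊥ ]
  subsetsOfSize zero    (suc k) = []
  subsetsOfSize (suc n) (suc k) =
    map (inside ∷_) (subsetsOfSize n k) ++ map (outside ∷_) (subsetsOfSize n (suc k))

  subsetsOfSize-size : (n k : ℕ) → All (λ S → ∣ S ∣ ≡ k) (subsetsOfSize n k)
  subsetsOfSize-size n       zero    = ∣⊥∣≡0 n ∷ []
  subsetsOfSize-size zero    (suc k) = []
  subsetsOfSize-size (suc n) (suc k) = ++⁺
    (map⁺ (All.map (cong suc) (subsetsOfSize-size n k)))
    (map⁺ (subsetsOfSize-size n (suc k)))

  length-subsetsOfSize : (n k : ℕ) → length (subsetsOfSize n k) ≡ n C k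
  length-subsetsOfSize n       zero    = refl
  length-subsetsOfSize zero    (suc k) = refl
  length-subsetsOfSize (suc n) (suc k) = begin
    length (map (inside ∷_) Sₖ ++ map (outside ∷_) Sₖ₊₁)
      ≡⟨ length-++ (map (inside ∷_) Sₖ) ⟩
    length (map (inside ∷_) Sₖ) + length (map (outside ∷_) Sₖ₊₁)
      ≡⟨ cong₂ _+_ (length-map (inside ∷_) Sₖ) (length-map (outside ∷_) Sₖ₊₁) ⟩
    length Sₖ + length Sₖ₊₁
      ≡⟨ cong₂ _+_ (length-subsetsOfSize n k) (length-subsetsOfSize n (suc k)) ⟩
    n C k + n C suc k
      ≡⟨ nCk+nC[k+1]≡[n+1]C[k+1] n k ⟩
    suc n C suc k ∎
    where
    open ≡-Reasoning
    Sₖ Sₖ₊₁ : List (Subset n)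
    Sₖ = subsetsOfSize n k
    Sₖ₊₁ = subsetsOfSize n (suc k)

  count-meeting : ∀ {n} (k t : ℕ) (B : Subset n) →
    count (λ S → t ≤? ∣ S ∩ B ∣) (subsetsOfSize n k) ≡ #meeting (∣ B ∣) (∣ ∁ B ∣) k t
  count-meeting {n} zero t B =
    trans (+-identityʳ _) (cong (λ m → 𝟙 (t ≤? m)) (trans (cong ∣_∣ (∩-zeroˡ B)) (∣⊥∣≡0 n)))
  count-meeting {zero} (suc k) t [] = sym (*-zeroʳ (𝟙 (t ≤? 0)))
  count-meeting {suc n} (suc k) t (inside ∷ B) = begin
    count (λ S → t ≤? ∣ S ∩ (inside ∷ B) ∣) (subsetsOfSize (suc n) (suc k))
      ≡⟨ count-++-map (λ S → t ≤? ∣ S ∩ (inside ∷ B) ∣) (inside ∷_) (outside ∷_) Sₖ Sₖ₊₁ ⟩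
    count (λ S → t ≤? suc ∣ S ∩ B ∣) Sₖ + count (λ S → t ≤? ∣ S ∩ B ∣) Sₖ₊₁
      ≡⟨ cong₂ _+_ (count-⇔ (λ S → t ≤? suc ∣ S ∩ B ∣) (λ S → t ∸ 1 ≤? ∣ S ∩ B ∣)
                            (λ {S} → ≤-suc⇔∸1≤ t ∣ S ∩ B ∣) Sₖ) refl ⟩
    count (λ S → t ∸ 1 ≤? ∣ S ∩ B ∣) Sₖ + count (λ S → t ≤? ∣ S ∩ B ∣) Sₖ₊₁
      ≡⟨ cong₂ _+_ (count-meeting k (t ∸ 1) B) (count-meeting (suc k) t B) ⟩
    #meeting (∣ B ∣) (∣ ∁ B ∣) k (t ∸ 1) + #meeting (∣ B ∣) (∣ ∁ B ∣) (suc k) t ∎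
    where
    open ≡-Reasoning
    Sₖ Sₖ₊₁ : List (Subset n)
    Sₖ = subsetsOfSize n k
    Sₖ₊₁ = subsetsOfSize n (suc k)
  count-meeting {suc n} (suc k) t (outside ∷ B) = begin
    count (λ S → t ≤? ∣ S ∩ (outside ∷ B) ∣) (subsetsOfSize (suc n) (suc k))
      ≡⟨ count-++-map (λ S → t ≤? ∣ S ∩ (outside ∷ B) ∣) (inside ∷_) (outside ∷_) Sₖ Sₖ₊₁ ⟩
    count (λ S → t ≤? ∣ S ∩ B ∣) Sₖ + count (λ S → t ≤? ∣ S ∩ B ∣) Sₖ₊₁
      ≡⟨ cong₂ _+_ (count-meeting k t B) (count-meeting (suc k) t B) ⟩
    #meeting (∣ B ∣) (∣ ∁ B ∣) k t + #meeting (∣ B ∣) (∣ ∁ B ∣) (suc k) t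
      ≡⟨ #meeting-suc-outside ∣ B ∣ ∣ ∁ B ∣ k t ⟨
    #meeting (∣ B ∣) (suc ∣ ∁ B ∣) (suc k) t ∎
    where
    open ≡-Reasoning
    Sₖ Sₖ₊₁ : List (Subset n)
    Sₖ = subsetsOfSize n k
    Sₖ₊₁ = subsetsOfSize n (suc k)

count-meeting-of-size : ∀ {n b} (k t : ℕ) {B : Subset n} → ∣ B ∣ ≡ b →
  count (λ S → t ≤? ∣ S ∩ B ∣) (subsetsOfSize n k) ≡ #meeting b (n ∸ b) k t
count-meeting-of-size k t {B} refl =
  trans (count-meeting k t B) (cong (λ c → #meeting ∣ B ∣ c k t) (∣∁p∣≡n∸∣p∣ B))

96-blocks-too-few : 96 * #meeting 6 54 6 3 < 60 C 6
96-blocks-too-few = <ᵇ⇒< (96 * #meeting 6 54 6 3) (60 C 6) _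

mainTheorem2 : (F : List (Subset 60)) → IsCovering 60 6 3 F → 97 ≤ length F
mainTheorem2 F (sizes , covers) = *-cancelʳ-< (#meeting 6 54 6 3) 96 (length F) (begin-strict
  96 * #meeting 6 54 6 3
    <⟨ 96-blocks-too-few ⟩
  60 C 6
    ≡⟨ length-subsetsOfSize 60 6 ⟨
  length (subsetsOfSize 60 6)
    ≤⟨ length≤sum-count (λ B S → 3 ≤? ∣ S ∩ B ∣) F (All.map (λ {S} → covers S) (subsetsOfSize-size 60 6)) ⟩
  sum (map (λ B → count (λ S → 3 ≤? ∣ S ∩ B ∣) (subsetsOfSize 60 6)) F)
    ≡⟨ sum-map-const _ (All.map (count-meeting-of-size 6 3) sizes) ⟩
  length F * #meeting 6 54 6 3 ∎)
  where open ≤-Reasoning
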